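{- Let $N$ be a plain structural conflict Petri net. If $N$ has a fully reachable pure M, then $N$ is not distributable up to step failures equivalence, i.e. there is no distributed net $N''$ with $N''\approx_\mathscr{F}N$.
   Context: Fix a set $\mathrm{Act}$ of visible actions and $\tau\notin\mathrm{Act}$. A Petri net is $N=(S,T,F,M_0,\ell)$ with disjoint $S$, $T$, $F:(S\times T\cup T\times S)\to\mathbb N$, $M_0\in\mathbb N^S$, $\ell:T\to\mathrm{Act}\cup\{\tau\}$; ${}^\bullet x(y)=F(y,x)$, $x^\bullet(y)=F(x,y)$, extended additively. $M[G\rangle M'$ (for a nonempty finite multiset $G$ of transitions) iff ${}^\bullet G\le M$, $M'=M-{}^\bullet G+G^\bullet$. $[M_0\rangle$: reachable markings; $t\smile u$ iff some reachable $M$ has $M[\{t\}+\{u\}\rangle$. Structural conflict net: $t\smile u\Rightarrow{}^\bullet t\cap{}^\bullet u=\emptyset$. Plain: $\ell$ injective with no $\tau$. Fully reachable pure M: $t,u,v\in T$ with ${}^\bullet t\cap{}^\bullet u\ne\emptyset$, ${}^\bullet u\cap{}^\bullet v\ne\emptyset$, ${}^\bullet t\cap{}^\bullet v=\emptyset$ and a reachable $M\ge{}^\bullet t\cup{}^\bullet u\cup{}^\bullet v$. Distributed net: there is $D:S\cup T\to\mathrm{Loc}$ with $s\in{}^\bullet t\Rightarrow D(s)=D(t)$ and $t\smile u\Rightarrow D(t)\ne D(u)$. Step failures: $M\xrightarrow{a}M'$ iff $M[t\rangle M'$ with $\ell(t)=a$; $\Rightarrow$ is the reflexive transitive closure of $\xrightarrow{\tau}$;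 $M\stackrel{a_1\cdots a_n}{\Longrightarrow}M'$ means $M\Rightarrow\xrightarrow{a_1}\Rightarrow\cdots\xrightarrow{a_n}\Rightarrow M'$. For a nonempty finite multiset $A$ over $\mathrm{Act}$, $M\xrightarrow{A}$ iff $M[G\rangle$ for some finite multiset $G$ of transitions with $\ell(G)=A$. $\langle\sigma,X\rangle$ ($\sigma\in\mathrm{Act}^*$, $X$ a finite set of nonempty finite multisets over $\mathrm{Act}$) is a step failure pair of $N$ iff some $M$ has $M_0\stackrel{\sigma}{\Longrightarrow}M$, $M\not\xrightarrow{\tau}$ and $M\not\xrightarrow{A}$ for all $A\in X$. $N_1\approx_\mathscr{F}N_2$ iff they have the same step failure pairs. -}

module Defs where

open import Data.Nat using (ℕ; _+_; _∸_; _≤_; _<_; _⊔_)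
open import Data.List using (List; []; _∷_; map)
open import Data.Nat.ListAction using (sum)
open import Data.List.NonEmpty using (List⁺; _∷_; toList; [_])
open import Data.List.Membership.Propositional using (_∈_)
open import Data.List.Relation.Binary.Permutation.Propositional using (_↭_)
open import Data.Maybe using (Maybe; just; nothing)
open import Data.Product using (Σ; ∃; _×_; _,_)
open import Data.Sum using (_⊎_; inj₁; inj₂)
open import Relation.Nullary using (¬_)
open import Relation.Binary.PropositionalEquality using (_≡_; _≢_)
open import Function.Bundles using (_⇔_)

-- Petri nets over a fixed type Act of visible actions.
-- Labels are  Maybe Act : 'nothing' plays the role of τ.
record Net (Act : Set) : Set₁ where
  field
    S  : Set
    T  : Set
    Fᵢ : S → T → ℕ
    Fₒ : T → S → ℕ
    M₀ : S → ℕ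
    ℓ  : T → Maybe Act

module _ {Act : Set} (N : Net Act) where
  open Net N

  Marking : Set
  Marking = S → ℕ

  _≤ᴹ_ : Marking → Marking → Set
  M ≤ᴹ M' = ∀ s → M s ≤ M' s

  -- pre- and postsets of a finite multiset (list up to order) of transitions
  pre : List T → Marking
  pre G s = sum (map (λ t → Fᵢ s t) G)

  post : List T → Marking
  post G s = sum (map (λ t → Fₒ t s) G)

  Fire : Marking → List⁺ T → Marking → Set
  Fire M G M' = (pre (toList G) ≤ᴹ M)
              × (∀ s → M' s ≡ (M s ∸ pre (toList G) s) + post (toList G) s)

  data Reachable : Marking → Set where
    init : Reachable M₀
    step : ∀ {M M'} (G : List⁺ T) → Reachable M → Fire M G M' → Reachable M'

  Concurrent : T → T → Set
  Concurrent t u = ∃ λ M → Reachable M × ∃ λ M' → Fire M (t ∷ u ∷ []) M'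

  PresetsMeet : T → T → Set
  PresetsMeet t u = ∃ λ s → (0 < Fᵢ s t) × (0 < Fᵢ s u)

  StructuralConflict : Set
  StructuralConflict = ∀ t u → Concurrent t u → ¬ PresetsMeet t u

  Plain : Set
  Plain = (∀ t u → ℓ t ≡ ℓ u → t ≡ u) × (∀ t → ℓ t ≢ nothing)

  -- fully reachable pure M;  ●t ∪ ●u ∪ ●v is the multiset union (pointwise max)
  FullyReachablePureM : Set
  FullyReachablePureM =
    ∃ λ t → ∃ λ u → ∃ λ v →
      PresetsMeet t u × PresetsMeet u v × ¬ PresetsMeet t v ×
      ∃ λ M → Reachable M × (∀ s → (Fᵢ s t ⊔ Fᵢ s u ⊔ Fᵢ s v) ≤ M s)

  Distributed : Set₁
  Distributed = ∃ λ (Loc : Set) → ∃ λ (D : S ⊎ T → Loc) →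
    (∀ s t → 0 < Fᵢ s t → D (inj₁ s) ≡ D (inj₂ t)) ×
    (∀ t u → Concurrent t u → D (inj₂ t) ≢ D (inj₂ u))

  _—[_]→_ : Marking → Maybe Act → Marking → Set
  M —[ α ]→ M' = ∃ λ t → ℓ t ≡ α × Fire M [ t ] M'

  data _⇒_ : Marking → Marking → Set where
    ⇒-refl : ∀ {M} → M ⇒ M
    ⇒-step : ∀ {M M' M''} → M —[ nothing ]→ M' → M' ⇒ M'' → M ⇒ M''

  data _=[_]⇒_ : Marking → List Act → Marking → Set where
    w-nil  : ∀ {M M'} → M ⇒ M' → M =[ [] ]⇒ M'
    w-cons : ∀ {M M₁ M₂ M'} {a σ} → M ⇒ M₁ → M₁ —[ just a ]→ M₂ →
             M₂ =[ σ ]⇒ M' → M =[ a ∷ σ ]⇒ M'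

  StepEnabled : Marking → List⁺ Act → Set
  StepEnabled M A = ∃ λ G → (map ℓ (toList G) ↭ map just (toList A))
                          × ∃ λ M' → Fire M G M'

  StepFailurePair : List Act → List (List⁺ Act) → Set
  StepFailurePair σ X = ∃ λ M → M₀ =[ σ ]⇒ M
    × (¬ ∃ λ M' → M —[ nothing ]→ M')
    × (∀ A → A ∈ X → ¬ StepEnabled M A)

_≈F_ : {Act : Set} → Net Act → Net Act → Set
N₁ ≈F N₂ = ∀ σ X → StepFailurePair N₁ σ X ⇔ StepFailurePair N₂ σ X

-- Let t, u, v (labelled a, b, c) form the pure M and let M be the reachable marking
-- covering their presets. A plain net is τ-free and deterministic, so M is its only
-- state after some trace σ; there {a, c} and b are enabled, while {a, b} and {b, c}
-- are blocked by structural conflict. A step failures equivalent N″ therefore has a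
-- stable state M″ after σ that refuses {a, b} and {b, c} yet (by determinism of N)
-- cannot refuse {a, c} or b. In a distributed N″, transitions whose locations differ
-- have disjoint presets, so refusing {a, b} and {b, c} forces the b-transition onto
-- the locations of both the a- and the c-transition, which are concurrent and so
-- lie on different locations.
module Submission where

open import Defs
open import Data.Empty using (⊥)
open import Data.List using ([]; _∷_; map; _++_)
open import Data.List.NonEmpty using (List⁺; _∷_; toList; [_])
open import Data.List.Properties using (∷-injective; ∷-injectiveˡ)
open import Data.List.Relation.Unary.Any using (here; there)
open import Data.List.Relation.Binary.Permutation.Propositional
  using (_↭_; ↭-refl; ↭-reflexive; swap)
open import Data.List.Relation.Binary.Permutation.Propositional.Properties
  using (↭-map-inv; ↭-singleton-inv; map⁺)
open import Data.Maybe using (just; nothing)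
open import Data.Nat using (zero; suc; _+_; _∸_; _≤_; _<_; _⊔_; z≤n; s≤s)
open import Data.Nat.ListAction.Properties using (sum-↭)
open import Data.Nat.Properties
open import Data.Sum using (inj₂)
open import Data.Product using (∃; ∃₂; _×_; _,_; proj₁; proj₂)
open import Function.Bundles using (Equivalence)
open import Relation.Nullary using (¬_)
open import Relation.Binary.PropositionalEquality
  using (_≡_; _≢_; _≗_; refl; sym; trans; cong; cong₂; subst; module ≡-Reasoning)

∸-+-sequential : ∀ {x p P} q Q → p + P ≤ x →
                 P ≤ x ∸ p + q × x ∸ (p + P) + (q + Q) ≡ x ∸ p + q ∸ P + Q
∸-+-sequential {x} {p} {P} q Q p+P≤x = P≤x∸p+q , sym sequential
  where
  P≤x∸p : P ≤ x ∸ p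
  P≤x∸p = subst (_≤ x ∸ p) (m+n∸m≡n p P) (∸-monoˡ-≤ p p+P≤x)

  P≤x∸p+q : P ≤ x ∸ p + q
  P≤x∸p+q = ≤-trans P≤x∸p (m≤m+n (x ∸ p) q)

  open ≡-Reasoning
  sequential : x ∸ p + q ∸ P + Q ≡ x ∸ (p + P) + (q + Q)
  sequential = begin
    x ∸ p + q ∸ P + Q     ≡⟨ cong (_+ Q) (+-∸-comm q P≤x∸p) ⟩
    x ∸ p ∸ P + q + Q     ≡⟨ +-assoc (x ∸ p ∸ P) q Q ⟩
    x ∸ p ∸ P + (q + Q)   ≡⟨ cong (_+ (q + Q)) (∸-+-assoc x p P) ⟩
    x ∸ (p + P) + (q + Q) ∎

+-≤-disjoint : ∀ {x y m} → (0 < x → 0 < y → ⊥) → x ≤ m → y ≤ m → x + y ≤ m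
+-≤-disjoint {zero}  _ _ y≤m = y≤m
+-≤-disjoint {suc x} {zero} _ x≤m _ = ≤-trans (≤-reflexive (+-identityʳ (suc x))) x≤m
+-≤-disjoint {suc x} {suc y} disjoint _ _ with () ← disjoint (s≤s z≤n) (s≤s z≤n)

module _ {Act : Set} (N : Net Act) where
  open Net N

  Enabled : Marking N → List⁺ T → Set
  Enabled M G = _≤ᴹ_ N (pre N (toList G)) M

  after : Marking N → List⁺ T → Marking N
  after M G s = M s ∸ pre N (toList G) s + post N (toList G) s

  Stable : Marking N → Set
  Stable M = ¬ ∃ λ M′ → _—[_]→_ N M nothing M′

  fire : ∀ {M G} → Enabled M G → Fire N M G (after M G)
  fire enabled = enabled , λ _ → refl

  Fire-functional : ∀ {M M′ G M₁ M₁′} → M ≗ M′ → Fire N M G M₁ → Fire N M′ G M₁′ → M₁ ≗ M₁′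
  Fire-functional {G = G} M≗M′ (_ , M₁≡) (_ , M₁′≡) s =
    trans (M₁≡ s) (trans (cong (λ m → m ∸ pre N (toList G) s + post N (toList G) s) (M≗M′ s))
                         (sym (M₁′≡ s)))

  Fire-∷ : ∀ {M M′} g h hs → Fire N M (g ∷ h ∷ hs) M′ →
           Fire N M [ g ] (after M [ g ]) × Fire N (after M [ g ]) (h ∷ hs) M′
  Fire-∷ {M} g h hs (enabled , M′≡) =
    fire {G = [ g ]} (λ s → m+n≤o⇒m≤o (Fᵢ s g + 0) (enabled-∷ s)) ,
    (λ s → proj₁ (sequential s)) ,
    λ s → trans (M′≡ s) (trans (cong₂ (λ p q → M s ∸ p + q) (pre-∷ s) (post-∷ s))
                                (proj₂ (sequential s)))
    where
    pre-∷ : ∀ s → pre N (g ∷ h ∷ hs) s ≡ pre N (g ∷ []) s + pre N (h ∷ hs) s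
    pre-∷ s = cong (_+ pre N (h ∷ hs) s) (sym (+-identityʳ (Fᵢ s g)))

    post-∷ : ∀ s → post N (g ∷ h ∷ hs) s ≡ post N (g ∷ []) s + post N (h ∷ hs) s
    post-∷ s = cong (_+ post N (h ∷ hs) s) (sym (+-identityʳ (Fₒ g s)))

    enabled-∷ : ∀ s → pre N (g ∷ []) s + pre N (h ∷ hs) s ≤ M s
    enabled-∷ s = subst (_≤ M s) (pre-∷ s) (enabled s)

    sequential : ∀ s → let p = pre N (g ∷ []) s; P = pre N (h ∷ hs) s
                           q = post N (g ∷ []) s; Q = post N (h ∷ hs) s in
                 P ≤ M s ∸ p + q × M s ∸ (p + P) + (q + Q) ≡ M s ∸ p + q ∸ P + Q
    sequential s =
      ∸-+-sequential {p = pre N (g ∷ []) s} (post N (g ∷ []) s) (post N (h ∷ hs) s) (enabled-∷ s)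

  Enabled-↭ : ∀ {M G H} → toList G ↭ toList H → Enabled M G → Enabled M H
  Enabled-↭ {M} G↭H enabled s =
    subst (_≤ M s) (sum-↭ (map⁺ (λ t → Fᵢ s t) G↭H)) (enabled s)

  Enabled-resp-≗ : ∀ {M M′ G} → M ≗ M′ → Enabled M G → Enabled M′ G
  Enabled-resp-≗ {G = G} M≗M′ enabled s = subst (pre N (toList G) s ≤_) (M≗M′ s) (enabled s)

  Enabled-head : ∀ {M t u} → Enabled M (t ∷ u ∷ []) → Enabled M [ t ]
  Enabled-head {t = t} enabled s = ≤-trans (+-monoʳ-≤ (Fᵢ s t) z≤n) (enabled s)

  Enabled-join : ∀ {M t u} → ¬ PresetsMeet N t u → Enabled M [ t ] → Enabled M [ u ] →
                 Enabled M (t ∷ u ∷ [])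
  Enabled-join {M} {t} {u} disjoint enabledₜ enabledᵤ s =
    +-≤-disjoint (λ 0<t 0<u → disjoint (s , 0<t , subst (0 <_) (+-identityʳ (Fᵢ s u)) 0<u))
      (subst (_≤ M s) (+-identityʳ (Fᵢ s t)) (enabledₜ s))
      (enabledᵤ s)

  pure-M-enabled : ∀ {M t u v} → ¬ PresetsMeet N t v →
                   (∀ s → Fᵢ s t ⊔ Fᵢ s u ⊔ Fᵢ s v ≤ M s) →
                   Enabled M (t ∷ v ∷ []) × Enabled M [ u ]
  pure-M-enabled {t = t} {u} {v} disjoint covers =
    Enabled-join disjoint (enabled-by λ s → m≤n⇒m≤n⊔o (Fᵢ s v) (m≤m⊔n (Fᵢ s t) (Fᵢ s u)))
                          (enabled-by λ s → m≤n⊔m (Fᵢ s t ⊔ Fᵢ s u) (Fᵢ s v)) ,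
    enabled-by λ s → m≤n⇒m≤n⊔o (Fᵢ s v) (m≤n⊔m (Fᵢ s t) (Fᵢ s u))
    where
    enabled-by : ∀ {x} → (∀ s → Fᵢ s x ≤ Fᵢ s t ⊔ Fᵢ s u ⊔ Fᵢ s v) → Enabled _ [ x ]
    enabled-by {x} x≤ s = ≤-trans (≤-reflexive (+-identityʳ (Fᵢ s x))) (≤-trans (x≤ s) (covers s))

  StepEnabled-[]⁺ : ∀ {M t a} → ℓ t ≡ just a → Enabled M [ t ] → StepEnabled N M [ a ]
  StepEnabled-[]⁺ {t = t} ℓt enabled =
    [ t ] , ↭-reflexive (cong (_∷ []) ℓt) , _ , fire {G = [ t ]} enabled

  StepEnabled-pair⁺ : ∀ {M t u a b} → ℓ t ≡ just a → ℓ u ≡ just b →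
                      Enabled M (t ∷ u ∷ []) → StepEnabled N M (a ∷ b ∷ [])
  StepEnabled-pair⁺ {t = t} {u} ℓt ℓu enabled =
    (t ∷ u ∷ []) , ↭-reflexive (cong₂ (λ x y → x ∷ y ∷ []) ℓt ℓu) , _ ,
    fire {G = t ∷ u ∷ []} enabled

  StepEnabled-[]⁻ : ∀ {M a} → StepEnabled N M [ a ] → ∃ λ t → ℓ t ≡ just a × Enabled M [ t ]
  StepEnabled-[]⁻ (t ∷ [] , labels , _ , enabled , _) =
    t , ∷-injectiveˡ (↭-singleton-inv labels) , enabled
  StepEnabled-[]⁻ (_ ∷ _ ∷ _ , labels , _) with () ← ↭-singleton-inv labels

  StepEnabled-pair⁻ : ∀ {M a b} → StepEnabled N M (a ∷ b ∷ []) →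
                      ∃₂ λ t u → ℓ t ≡ just a × ℓ u ≡ just b × Enabled M (t ∷ u ∷ [])
  StepEnabled-pair⁻ (G , labels , _ , enabled , _) with ↭-map-inv ℓ labels
  ... | t ∷ u ∷ [] , labels≡ , G↭tu =
    let ℓt≡ , ℓu∷[]≡ = ∷-injective labels≡
    in t , u , sym ℓt≡ , sym (∷-injectiveˡ ℓu∷[]≡) , Enabled-↭ {G = G} G↭tu enabled
  ... | [] , () , _
  ... | _ ∷ [] , () , _
  ... | _ ∷ _ ∷ _ ∷ _ , () , _

  StepEnabled-resp-≗ : ∀ {M M′ A} → M ≗ M′ → StepEnabled N M A → StepEnabled N M′ A
  StepEnabled-resp-≗ M≗M′ (G , labels , _ , enabled , _) =
    G , labels , _ , fire {G = G} (Enabled-resp-≗ {G = G} M≗M′ enabled)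

  ⇒-trans : ∀ {M M₁ M₂} → _⇒_ N M M₁ → _⇒_ N M₁ M₂ → _⇒_ N M M₂
  ⇒-trans ⇒-refl q = q
  ⇒-trans (⇒-step τ p) q = ⇒-step τ (⇒-trans p q)

  ⇒-trace : ∀ {M M₁ M′ σ} → _⇒_ N M M₁ → _=[_]⇒_ N M₁ σ M′ → _=[_]⇒_ N M σ M′
  ⇒-trace p (w-nil q) = w-nil (⇒-trans p q)
  ⇒-trace p (w-cons q st tr) = w-cons (⇒-trans p q) st tr

  trace-++ : ∀ {M M₁ M′ σ ρ} → _=[_]⇒_ N M σ M₁ → _=[_]⇒_ N M₁ ρ M′ → _=[_]⇒_ N M (σ ++ ρ) M′
  trace-++ (w-nil p) tr = ⇒-trace p tr
  trace-++ (w-cons p st tr₁) tr₂ = w-cons p st (trace-++ tr₁ tr₂)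

  ⇒-reachable : ∀ {M M′} → Reachable N M → _⇒_ N M M′ → Reachable N M′
  ⇒-reachable r ⇒-refl = r
  ⇒-reachable r (⇒-step (t , _ , f) p) = ⇒-reachable (step [ t ] r f) p

  trace-reachable : ∀ {M M′ σ} → Reachable N M → _=[_]⇒_ N M σ M′ → Reachable N M′
  trace-reachable r (w-nil p) = ⇒-reachable r p
  trace-reachable r (w-cons p (t , _ , f) tr) = trace-reachable (step [ t ] (⇒-reachable r p) f) tr

  module _ (plain : Plain N) where
    private
      ℓ-injective : ∀ t u → ℓ t ≡ ℓ u → t ≡ u
      ℓ-injective = proj₁ plain

    visible : ∀ t → ∃ λ a → ℓ t ≡ just a
    visible t with ℓ t in ℓt
    ... | just a = a , refl
    ... | nothing with () ← proj₂ plain t ℓt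

    plain-stable : ∀ {M} → Stable M
    plain-stable (_ , t , ℓt , _) = proj₂ plain t ℓt

    plain-⇒ : ∀ {M M′} → _⇒_ N M M′ → M ≡ M′
    plain-⇒ ⇒-refl = refl
    plain-⇒ (⇒-step τ _) with () ← plain-stable (_ , τ)

    fire-trace : ∀ {M M′} g gs → Fire N M (g ∷ gs) M′ → ∃ λ σ → _=[_]⇒_ N M σ M′
    fire-trace g [] f =
      let a , ℓg = visible g in a ∷ [] , w-cons ⇒-refl (g , ℓg , f) (w-nil ⇒-refl)
    fire-trace g (h ∷ hs) f =
      let f₁ , f₂ = Fire-∷ g h hs f
          σ , tr₁ = fire-trace g [] f₁
          ρ , tr₂ = fire-trace h hs f₂
      in σ ++ ρ , trace-++ tr₁ tr₂

    reachable-trace : ∀ {M} → Reachable N M → ∃ λ σ → _=[_]⇒_ N M₀ σ M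
    reachable-trace init = [] , w-nil ⇒-refl
    reachable-trace (step (g ∷ gs) r f) =
      let σ , tr₁ = reachable-trace r
          ρ , tr₂ = fire-trace g gs f
      in σ ++ ρ , trace-++ tr₁ tr₂

    trace-deterministic : ∀ {M M′ M₁ M₁′ σ} → M ≗ M′ →
                          _=[_]⇒_ N M σ M₁ → _=[_]⇒_ N M′ σ M₁′ → M₁ ≗ M₁′
    trace-deterministic M≗M′ (w-nil p) (w-nil p′) with plain-⇒ p | plain-⇒ p′
    ... | refl | refl = M≗M′
    trace-deterministic M≗M′ (w-cons p (t , ℓt , f) tr) (w-cons p′ (t′ , ℓt′ , f′) tr′)
      with plain-⇒ p | plain-⇒ p′ | ℓ-injective t t′ (trans ℓt (sym ℓt′))
    ... | refl | refl | refl = trace-deterministic (Fire-functional {G = [ t ]} M≗M′ f f′) tr tr′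

    conflict-refused : ∀ {M t u a b} → StructuralConflict N → Reachable N M →
                       ℓ t ≡ just a → ℓ u ≡ just b → PresetsMeet N t u →
                       ¬ StepEnabled N M (a ∷ b ∷ [])
    conflict-refused {t = t} {u} sc r ℓt ℓu meet enabled with StepEnabled-pair⁻ enabled
    ... | t′ , u′ , ℓt′ , ℓu′ , enabled′
      with ℓ-injective t′ t (trans ℓt′ (sym ℓt)) | ℓ-injective u′ u (trans ℓu′ (sym ℓu))
    ... | refl | refl = sc t u (_ , r , _ , fire {G = t ∷ u ∷ []} enabled′) meet

    pure-M-steps : StructuralConflict N → FullyReachablePureM N →
      ∃₂ λ σ M → ∃₂ λ a b → ∃ λ c → _=[_]⇒_ N M₀ σ M ×
        StepEnabled N M (a ∷ c ∷ []) × StepEnabled N M [ b ] ×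
        ¬ StepEnabled N M (a ∷ b ∷ []) × ¬ StepEnabled N M (b ∷ c ∷ [])
    pure-M-steps sc (t , u , v , t∩u , u∩v , t∩v=∅ , M , reachable , covers) =
      let σ , tr = reachable-trace reachable
          a , ℓt = visible t
          b , ℓu = visible u
          c , ℓv = visible v
          enabledₜᵥ , enabledᵤ = pure-M-enabled t∩v=∅ covers
      in σ , M , a , b , c , tr ,
         StepEnabled-pair⁺ ℓt ℓv enabledₜᵥ , StepEnabled-[]⁺ ℓu enabledᵤ ,
         conflict-refused sc reachable ℓt ℓu t∩u , conflict-refused sc reachable ℓu ℓv u∩v

≈F-plain-enabled : ∀ {Act} {N N″ : Net Act} {σ M M″ A} → Plain N → N″ ≈F N →
                   _=[_]⇒_ N (Net.M₀ N) σ M → StepEnabled N M A →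
                   _=[_]⇒_ N″ (Net.M₀ N″) σ M″ → Stable N″ M″ → ¬ ¬ StepEnabled N″ M″ A
≈F-plain-enabled {N = N} {A = A} plain N″≈N tr enabled tr″ stable″ refused
  with Equivalence.to (N″≈N _ (A ∷ [])) (_ , tr″ , stable″ , λ { _ (here refl) → refused })
... | _ , tr₁ , _ , refuses₁ =
  refuses₁ A (here refl)
    (StepEnabled-resp-≗ N (trace-deterministic N plain (λ _ → refl) tr tr₁) enabled)

distributed⇒¬pure-M-refusal : ∀ {Act} {N : Net Act} {M a b c} → Distributed N → Reachable N M →
  StepEnabled N M (a ∷ c ∷ []) → StepEnabled N M [ b ] →
  ¬ StepEnabled N M (a ∷ b ∷ []) → ¬ StepEnabled N M (b ∷ c ∷ []) → ⊥
distributed⇒¬pure-M-refusal {N = N} {M} (_ , D , located , concurrent-apart) r ac b ¬ab ¬bc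
  with StepEnabled-pair⁻ N ac | StepEnabled-[]⁻ N b
... | t , v , ℓt , ℓv , enabledₜᵥ | u , ℓu , enabledᵤ =
  colocated ℓt ℓu enabledₜ enabledᵤ ¬ab λ t≡u →
  colocated ℓu ℓv enabledᵤ enabledᵥ ¬bc λ u≡v →
  concurrent-apart t v (_ , r , _ , fire N {G = t ∷ v ∷ []} enabledₜᵥ) (trans t≡u u≡v)
  where
  open Net N using (T; ℓ)

  enabledₜ : Enabled N M [ t ]
  enabledₜ = Enabled-head N enabledₜᵥ

  enabledᵥ : Enabled N M [ v ]
  enabledᵥ = Enabled-head N (Enabled-↭ N {G = t ∷ v ∷ []} (swap t v ↭-refl) enabledₜᵥ)

  colocated : ∀ {x y : T} {a b} → ℓ x ≡ just a → ℓ y ≡ just b →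
              Enabled N M [ x ] → Enabled N M [ y ] → ¬ StepEnabled N M (a ∷ b ∷ []) →
              ¬ D (inj₂ x) ≢ D (inj₂ y)
  colocated {x} {y} ℓx ℓy enabledₓ enabledᵧ refused apart =
    refused (StepEnabled-pair⁺ N ℓx ℓy (Enabled-join N disjoint enabledₓ enabledᵧ))
    where
    disjoint : ¬ PresetsMeet N x y
    disjoint (s , 0<x , 0<y) = apart (trans (sym (located s x 0<x)) (located s y 0<y))

theorem5p6 : {Act : Set} (N : Net Act) → Plain N → StructuralConflict N →
    FullyReachablePureM N → ¬ (∃ λ (N″ : Net Act) → Distributed N″ × (N″ ≈F N))
theorem5p6 N plain sc pure-M (N″ , distributed , N″≈N) =
  let σ , M , a , b , c , tr , ac , b-enabled , ¬ab , ¬bc = pure-M-steps N plain sc pure-M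
      _ , tr″ , stable″ , refuses″ = Equivalence.from (N″≈N σ ((a ∷ b ∷ []) ∷ (b ∷ c ∷ []) ∷ []))
        (M , tr , plain-stable N plain , λ where _ (here refl)         → ¬ab
                                                 _ (there (here refl)) → ¬bc)
  in
  ≈F-plain-enabled plain N″≈N tr ac tr″ stable″ λ ac″ →
  ≈F-plain-enabled plain N″≈N tr b-enabled tr″ stable″ λ b″ →
  distributed⇒¬pure-M-refusal distributed (trace-reachable N″ init tr″) ac″ b″
    (refuses″ _ (here refl)) (refuses″ _ (there (here refl)))
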